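{- Let $F$ be a freezing cellular automaton of dimension $2$ with neighborhood $\mathrm{VN}_2=\{(0,0),(\pm1,0),(0,\pm1)\}$. Let $c$ be a configuration, $z\in\mathbb{Z}^2$, and $t\geq1$ such that $F^t(c)_z\neq c_z$. Then there exist a position $z'$ which is unstable in $c$ and a changing path from $z$ to $z'$ between $c$ and $F^t(c)$ of length at most $t$.
   Context: A cellular automaton $F=(2,Q,N,f)$ has global function $F(c)_z=f(c|_{z+N})$; it is freezing if for some partial order $\preceq$ on $Q$, $F(c)_z\preceq c_z$ for all $c,z$. A position $z$ is stable in $c$ if $F(c)_z=c_z$, and unstable otherwise. A changing path from $z$ to $z'$ between configurations $c$ and $F^t(c)$ is a sequence $z_1,\ldots,z_n$ of positions with $z_1=z$, $z_n=z'$, $z_{i+1}\in z_i+\mathrm{VN}_2$ for all $i<n$, and $c_{z_i}\neq F^t(c)_{z_i}$ for all $i$; its length is $n$. -}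

module Defs where

open import Data.Nat using (ℕ; zero; suc)
open import Data.Integer using (ℤ; _+_; -_; +_)
open import Data.Fin using (Fin)
open import Data.Product using (_×_; _,_; Σ)
open import Data.List using (List; []; _∷_; length)
open import Data.List.Relation.Unary.All using (All)
open import Relation.Binary.PropositionalEquality using (_≡_; _≢_)
open import Relation.Binary.Structures using (IsPartialOrder)
open import Data.Sum using (_⊎_)
open import Level using (0ℓ; suc)

Pos : Set
Pos = ℤ × ℤ

_⊕_ : Pos → Pos → Pos
(a , b) ⊕ (c , d) = (a + c , b + d)

data VN₂ : Pos → Set where
  vn-0  : VN₂ (+ 0 , + 0)
  vn-e  : VN₂ (+ 1 , + 0)
  vn-w  : VN₂ (- + 1 , + 0)
  vn-n  : VN₂ (+ 0 , + 1)
  vn-s  : VN₂ (+ 0 , - + 1)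

LocalRule : ℕ → Set
LocalRule k = Fin k → Fin k → Fin k → Fin k → Fin k → Fin k

Config : ℕ → Set
Config k = Pos → Fin k

global : ∀ {k} → LocalRule k → Config k → Config k
global f c z =
  f (c (z ⊕ (+ 0 , + 0))) (c (z ⊕ (+ 1 , + 0))) (c (z ⊕ (- + 1 , + 0)))
    (c (z ⊕ (+ 0 , + 1))) (c (z ⊕ (+ 0 , - + 1)))

iterate : ∀ {k} → LocalRule k → ℕ → Config k → Config k
iterate f zero c = c
iterate f (suc n) c = global f (iterate f n c)

Freezing : ∀ {k} → LocalRule k → Set₁
Freezing {k} f =
  Σ (Fin k → Fin k → Set) λ _⪯_ →
    IsPartialOrder _≡_ _⪯_ × (∀ (c : Config k) (z : Pos) → global f c z ⪯ c z)

Unstable : ∀ {k} → LocalRule k → Config k → Pos → Set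
Unstable f c z = global f c z ≢ c z

data Adjacent : List Pos → Set where
  adj-[]  : Adjacent []
  adj-[x] : ∀ {x} → Adjacent (x ∷ [])
  adj-∷   : ∀ {x y ps} → Σ Pos (λ v → VN₂ v × (y ≡ x ⊕ v)) →
            Adjacent (y ∷ ps) → Adjacent (x ∷ y ∷ ps)

data Last {A : Set} : List A → A → Set where
  last-[x] : ∀ {x} → Last (x ∷ []) x
  last-∷   : ∀ {x y ys l} → Last (y ∷ ys) l → Last (x ∷ y ∷ ys) l

record ChangingPath {k} (c d : Config k) (z z' : Pos) : Set where
  field
    rest     : List Pos
    ends     : Last (z ∷ rest) z'
    adjacent : Adjacent (z ∷ rest)
    changing : All (λ p → c p ≢ d p) (z ∷ rest)

pathLength : ∀ {k} {c d : Config k} {z z' : Pos} → ChangingPath c d z z' → ℕ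
pathLength {z = z} p = length (z ∷ ChangingPath.rest p)

module Submission where

-- Since F is freezing, every iterate
-- F^n(c) lies below c pointwise, hence a cell that differs from c at time n
-- still differs from c at every later time: changes are permanent.  If z is unstable in c, the one-point path z
-- suffices.  Otherwise F(c)_z = c_z, and F^{t}(c)_z = F(F^{t-1}(c))_z; by
-- locality of F, F^{t-1}(c) cannot agree with c on all of z + VN₂, so some
-- neighbour z+v already changed at time t-1 (necessarily t ≥ 2, since for
-- t = 1 the cell z itself would be unstable).  By induction there is a
-- changing path of length ≤ t-1 from z+v to an unstable cell between c and
-- F^{t-1}(c); by permanence it is also changing between c and F^t(c), and
-- prepending z gives the required path of length ≤ t.

open import Defs
open import Data.Nat using (ℕ; _≤_; _≥_; zero; suc; s≤s; z≤n)
open import Data.Product using (Σ; _×_; _,_)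
open import Data.Sum using (_⊎_; inj₁; inj₂)
open import Data.List using ([]; _∷_)
open import Data.List.Relation.Unary.All as All using ([]; _∷_)
open import Data.Fin.Properties using (_≟_)
open import Data.Integer using (+_; -_)
open import Relation.Nullary using (yes; no; contradiction)
open import Relation.Binary.Structures using (IsPartialOrder)
open import Relation.Binary.PropositionalEquality
  using (_≡_; _≢_; refl; sym; subst; module ≡-Reasoning)

module ChangingPaths {k : ℕ} {c : Config k} where

  singletonPath : ∀ {d z} → c z ≢ d z → ChangingPath c d z z
  singletonPath changed = record
    { rest = [] ; ends = last-[x] ; adjacent = adj-[x] ; changing = changed ∷ [] }

  consPath : ∀ {d z v z'} → VN₂ v → c z ≢ d z →
             ChangingPath c d (z ⊕ v) z' → ChangingPath c d z z'
  consPath {z = z} {v = v} vn changed p = record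
    { rest     = z ⊕ v ∷ ChangingPath.rest p
    ; ends     = last-∷ (ChangingPath.ends p)
    ; adjacent = adj-∷ (v , vn , refl) (ChangingPath.adjacent p)
    ; changing = changed ∷ ChangingPath.changing p }

  transportPath : ∀ {d d' z z'} → (∀ p → c p ≢ d p → c p ≢ d' p) →
                  ChangingPath c d z z' → ChangingPath c d' z z'
  transportPath grows p = record
    { rest = ChangingPath.rest p ; ends = ChangingPath.ends p
    ; adjacent = ChangingPath.adjacent p
    ; changing = All.map (λ {q} → grows q) (ChangingPath.changing p) }

open ChangingPaths

AgreeAround : ∀ {k} → Config k → Config k → Pos → Set
AgreeAround c d z = ∀ v → VN₂ v → c (z ⊕ v) ≡ d (z ⊕ v)

global-local : ∀ {k} (f : LocalRule k) (c d : Config k) (z : Pos) →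
               AgreeAround c d z → global f c z ≡ global f d z
global-local f c d z agree =
  cong₅ (agree _ vn-0) (agree _ vn-e) (agree _ vn-w) (agree _ vn-n) (agree _ vn-s)
  where
  cong₅ : ∀ {a₁ a₂ a₃ a₄ a₅ b₁ b₂ b₃ b₄ b₅} → a₁ ≡ b₁ → a₂ ≡ b₂ → a₃ ≡ b₃ →
          a₄ ≡ b₄ → a₅ ≡ b₅ → f a₁ a₂ a₃ a₄ a₅ ≡ f b₁ b₂ b₃ b₄ b₅
  cong₅ refl refl refl refl refl = refl

neighbour-dichotomy : ∀ {k} (c d : Config k) (z : Pos) →
  Σ Pos (λ v → VN₂ v × c (z ⊕ v) ≢ d (z ⊕ v)) ⊎ AgreeAround c d z
neighbour-dichotomy c d z
  with c (z ⊕ (+ 0 , + 0)) ≟ d (z ⊕ (+ 0 , + 0))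
     | c (z ⊕ (+ 1 , + 0)) ≟ d (z ⊕ (+ 1 , + 0))
     | c (z ⊕ (- + 1 , + 0)) ≟ d (z ⊕ (- + 1 , + 0))
     | c (z ⊕ (+ 0 , + 1)) ≟ d (z ⊕ (+ 0 , + 1))
     | c (z ⊕ (+ 0 , - + 1)) ≟ d (z ⊕ (+ 0 , - + 1))
... | no ne | _ | _ | _ | _ = inj₁ (_ , vn-0 , ne)
... | yes _ | no ne | _ | _ | _ = inj₁ (_ , vn-e , ne)
... | yes _ | yes _ | no ne | _ | _ = inj₁ (_ , vn-w , ne)
... | yes _ | yes _ | yes _ | no ne | _ = inj₁ (_ , vn-n , ne)
... | yes _ | yes _ | yes _ | yes _ | no ne = inj₁ (_ , vn-s , ne)
... | yes e₀ | yes e₁ | yes e₂ | yes e₃ | yes e₄ = inj₂ λ where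
  _ vn-0 → e₀
  _ vn-e → e₁
  _ vn-w → e₂
  _ vn-n → e₃
  _ vn-s → e₄

module Freezing-CA {k : ℕ} (f : LocalRule k) (freezing : Freezing f) where

  open Σ freezing renaming (proj₁ to _⪯_)
  open Σ (Σ.proj₂ freezing) renaming (proj₁ to isPartialOrder; proj₂ to decreasing)
  open IsPartialOrder isPartialOrder using (reflexive; antisym) renaming (trans to ⪯-trans)

  iterate-below : ∀ n (c : Config k) p → iterate f n c p ⪯ c p
  iterate-below zero c p = reflexive refl
  iterate-below (suc n) c p = ⪯-trans (decreasing (iterate f n c) p) (iterate-below n c p)

  -- Changes are permanent: a cell changed at time n is still changed at n+1,
  -- since c_p = F^{n+1}(c)_p ⪯ F^n(c)_p ⪯ c_p forces F^n(c)_p = c_p.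
  change-persists : ∀ n (c : Config k) p →
                    c p ≢ iterate f n c p → c p ≢ iterate f (suc n) c p
  change-persists n c p changed same = changed (sym (antisym (iterate-below n c p)
    (subst (_⪯ iterate f n c p) (sym same) (decreasing (iterate f n c) p))))

  ShortPathToUnstable : Config k → ℕ → Pos → Set
  ShortPathToUnstable c t z = Σ Pos λ z' → Unstable f c z' ×
    Σ (ChangingPath c (iterate f t c) z z') λ p → pathLength p ≤ t

  unstable-witness : ∀ c t z → 1 ≤ t → Unstable f c z →
                     iterate f t c z ≢ c z → ShortPathToUnstable c t z
  unstable-witness c t z 1≤t unstable changed =
    z , unstable , singletonPath (λ e → changed (sym e)) , 1≤t

  -- A stable cell cannot change unless some neighbour changed one step
  -- earlier: otherwise locality gives F^{n+1}(c)_z = F(c)_z = c_z.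
  changed-neighbour : ∀ c n z → global f c z ≡ c z → iterate f (suc n) c z ≢ c z →
    Σ Pos λ v → VN₂ v × c (z ⊕ v) ≢ iterate f n c (z ⊕ v)
  changed-neighbour c n z stable changed with neighbour-dichotomy c (iterate f n c) z
  ... | inj₁ neighbour = neighbour
  ... | inj₂ agree = contradiction stays changed
    where
    open ≡-Reasoning
    stays : iterate f (suc n) c z ≡ c z
    stays = begin
      global f (iterate f n c) z ≡⟨ sym (global-local f c (iterate f n c) z agree) ⟩
      global f c z               ≡⟨ stable ⟩
      c z                        ∎

  short-path : ∀ c n z → iterate f (suc n) c z ≢ c z → ShortPathToUnstable c (suc n) z
  short-path c zero z changed = unstable-witness c 1 z (s≤s z≤n) changed changed
  short-path c (suc n) z changed with global f c z ≟ c z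
  ... | no unstable = unstable-witness c (suc (suc n)) z (s≤s z≤n) unstable changed
  ... | yes stable with changed-neighbour c (suc n) z stable changed
  ... | v , vn , neighbourChanged
    with short-path c n (z ⊕ v) (λ e → neighbourChanged (sym e))
  ... | z' , unstable , p , length≤ =
    z' , unstable ,
    consPath vn (λ e → changed (sym e)) (transportPath (change-persists (suc n) c) p) ,
    s≤s length≤

mainTheorem8 : (k : ℕ) (f : LocalRule k) → Freezing f →
    (c : Config k) (z : Pos) (t : ℕ) → t ≥ 1 →
    iterate f t c z ≢ c z →
    Σ Pos λ z' → Unstable f c z' ×
    Σ (ChangingPath c (iterate f t c) z z') λ p → pathLength p ≤ t
mainTheorem8 k f freezing c z (suc n) _ changed =
  Freezing-CA.short-path f freezing c n z changed
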